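{- For every finite abelian group $G$ with $|G|\ge 3$ we have $s_{\min}(G)\ge 2$. Equality $s_{\min}(G)=2$ holds if and only if $G$ has a cyclic subgroup of index $2$; that is, if and only if either $G$ is cyclic of even order, or $G$ is of type $(2,m)$ with $m\ge 2$ even.
   Context: For a finite abelian group $G$ with $n=|G|$, let $\mathcal C(G)$ be the set of Hamiltonian cycles in the complete digraph on vertex set $G$; a cycle is written $C=(g_1,\ldots,g_n)$, a listing of all elements of $G$, indices modulo $n$. Let $S(C)=\{g_i+g_{i+1} : 1\le i\le n\}$ (indices mod $n$) and $s_{\min}(G)=\min\{|S(C)| : C\in\mathcal C(G)\}$. "$G$ is of type $(2,m)$" means $G\cong \mathbb Z/2\mathbb Z\oplus\mathbb Z/m\mathbb Z$ with $2\mid m$. -}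

module Defs where

open import Level using (0ℓ)
open import Algebra.Bundles using (AbelianGroup)
open import Data.Nat using (ℕ; zero; suc; _+_; _*_; _≤_)
open import Data.Nat.Divisibility using (_∣_)
open import Data.Nat.DivMod using (_mod_)
open import Data.Fin using (Fin; toℕ)
open import Data.Product using (Σ; ∃; _×_; _,_)
open import Function.Bundles using (Inverse)
import Relation.Binary.PropositionalEquality as ≡
open ≡ using (_≡_)

record FiniteAbelianGroup : Set₁ where
  field
    abGroup : AbelianGroup 0ℓ 0ℓ
  open AbelianGroup abGroup public
  field
    order       : ℕ
    enumeration : Inverse (≡.setoid (Fin order)) setoid

module _ (G : FiniteAbelianGroup) where
  open FiniteAbelianGroup G

  SubsetSize : (Carrier → Set) → ℕ → Set
  SubsetSize P k =
    Σ (Fin k → Carrier) λ e →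
      (∀ i j → e i ≈ e j → i ≡ j) ×
      (∀ j → P (e j)) ×
      (∀ x → P x → ∃ λ j → e j ≈ x)

next : ∀ {n} → Fin n → Fin n
next {suc m} i = suc (toℕ i) mod suc m

_+ₘ_ : ∀ {m} → Fin m → Fin m → Fin m
_+ₘ_ {suc m} a b = (toℕ a + toℕ b) mod suc m

module _ (G : FiniteAbelianGroup) where
  open FiniteAbelianGroup G

  -- Hamiltonian cycle in the complete digraph on G:
  -- a listing (g_1, …, g_n) of all elements of G, n = |G|, indices mod n
  record HamCycle : Set where
    field
      list      : Fin order → Carrier
      injective : ∀ i j → list i ≈ list j → i ≡ j
      surjective : ∀ x → ∃ λ i → list i ≈ x

  S : HamCycle → Carrier → Set
  S C x = ∃ λ i → (HamCycle.list C i ∙ HamCycle.list C (next i)) ≈ x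

  SizeS : HamCycle → ℕ → Set
  SizeS C k = SubsetSize G (S C) k

  SminGe : ℕ → Set
  SminGe k = ∀ (C : HamCycle) j → SizeS C j → k ≤ j

  SminEq : ℕ → Set
  SminEq k = SminGe k × Σ HamCycle λ C → SizeS C k

  times : ℕ → Carrier → Carrier
  times zero    g = ε
  times (suc k) g = g ∙ times k g

  -- the cyclic subgroup ⟨g⟩ = { k·g : k ∈ ℕ }  (G finite, so ℕ-multiples suffice)
  ⟨_⟩ : Carrier → Carrier → Set
  ⟨ g ⟩ x = ∃ λ k → times k g ≈ x

  HasCyclicSubgroupOfIndex2 : Set
  HasCyclicSubgroupOfIndex2 =
    ∃ λ g → ∃ λ k → SubsetSize G ⟨ g ⟩ k × 2 * k ≡ order

  IsCyclic : Set
  IsCyclic = ∃ λ g → ∀ x → ⟨ g ⟩ x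

  IsOfType2 : ℕ → Set
  IsOfType2 m =
    (2 ∣ m) ×
    Σ (Fin 2 × Fin m → Carrier) λ φ →
      (∀ a b c d → φ (a +ₘ c , b +ₘ d) ≈ (φ (a , b) ∙ φ (c , d))) ×
      (∀ p q → φ p ≈ φ q → p ≡ q) ×
      (∀ x → ∃ λ p → φ p ≈ x)

{-# OPTIONS --safe #-}
module Submission where

-- Two consecutive sums g_k + g_{k+1} and g_{k+1} + g_{k+2} differ because g_k ≠ g_{k+2} once
-- n ≥ 3, so |S(C)| ≥ 2. If |S(C)| = 2 the sums alternate between s₀ and s₁; hence n = 2m is
-- even and g_{2j} = g_0 + j(s₁ - s₀), so s₁ - s₀ has order m. Conversely, if g has order
-- m = n/2 and h ∉ ⟨g⟩, the zigzag cycle 0, h, g, h - g, 2g, h - 2g, … has sums h and h + g only.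
-- Finally G = ⟨g⟩ ∪ (h + ⟨g⟩) forces 2h = jg, and replacing h by h - ⌊j/2⌋g gives 2h ∈ {0, g}
-- (when m is odd, 0 = mg turns the first case into the second). If 2h = g then h generates G;
-- if 2h = 0 and m is even, (a, b) ↦ ah + bg is an isomorphism ℤ/2 ⊕ ℤ/m ≅ G.

open import Defs
open import Data.Nat using (_≤_)
open import Data.Nat.Divisibility using (_∣_)
open import Data.Product using (∃; _×_)
open import Data.Sum using (_⊎_)
open import Function.Bundles using (_⇔_)

open import Data.Nat as ℕ
  using (ℕ; zero; suc; _+_; _*_; _∸_; _<_; _<?_; z≤n; s≤s; z<s; NonZero; >-nonZero; _%_; _/_)
open import Data.Nat.Properties
open import Data.Nat.DivMod
  using (_mod_; m≡m%n+[m/n]*n; m<n⇒m%n≡m; n%n≡0; m%n%n≡m%n; %-distribˡ-+; [m+n]%n≡m%n)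
open import Data.Nat.Divisibility using (divides; ∣m+n∣m⇒∣n; n∣m*n; ∣⇒≤)
open import Data.Fin as Fin using (Fin; toℕ; fromℕ<)
open import Data.Fin.Patterns using (0F; 1F)
import Data.Fin.Properties as Fin
open import Data.Product using (_,_; proj₁; proj₂; uncurry)
open import Data.Unit using (⊤; tt)
open import Data.Sum using (inj₁; inj₂)
open import Data.Empty using (⊥; ⊥-elim)
open import Relation.Binary.Definitions using (tri<; tri≈; tri>)
open import Function using (_∘_)
open import Function.Bundles using (Inverse; mk⇔)
open import Relation.Nullary using (¬_; Dec; yes; no)
open import Relation.Nullary.Decidable using (map′; ¬?; _×-dec_; decidable-stable)
open import Relation.Unary using (Decidable)
open import Relation.Binary.PropositionalEquality as ≡ using (_≡_; _≢_)

data EvenOrOdd (k : ℕ) : Set where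
  even : ∀ j → 2 * j ≡ k → EvenOrOdd k
  odd  : ∀ j → suc (2 * j) ≡ k → EvenOrOdd k

evenOrOdd : ∀ k → EvenOrOdd k
evenOrOdd zero = even 0 ≡.refl
evenOrOdd (suc k) with evenOrOdd k
... | even j ≡.refl = odd j ≡.refl
... | odd j ≡.refl  = even (suc j) (*-suc 2 j)

interleave : {A : Set} → (ℕ → A) → (ℕ → A) → ℕ → A
interleave a b zero          = a 0
interleave a b (suc zero)    = b 0
interleave a b (suc (suc k)) = interleave (a ∘ suc) (b ∘ suc) k

interleave-even : {A : Set} (a b : ℕ → A) (j : ℕ) → interleave a b (2 * j) ≡ a j
interleave-even a b zero    = ≡.refl
interleave-even a b (suc j) =
  ≡.trans (≡.cong (interleave a b) (*-suc 2 j)) (interleave-even (a ∘ suc) (b ∘ suc) j)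

interleave-odd : {A : Set} (a b : ℕ → A) (j : ℕ) → interleave a b (suc (2 * j)) ≡ b j
interleave-odd a b zero    = ≡.refl
interleave-odd a b (suc j) =
  ≡.trans (≡.cong (interleave a b ∘ suc) (*-suc 2 j)) (interleave-odd (a ∘ suc) (b ∘ suc) j)

least-witness : {P : ℕ → Set} → Decidable P → ∀ {k} → P k →
                ∃ λ m → P m × (∀ {i} → i < m → ¬ P i)
least-witness {P} P? {k} pk
  with Fin.¬∀⟶∃¬-smallest (suc k) (¬_ ∘ P ∘ toℕ) (¬? ∘ P? ∘ toℕ)
         (λ ∀¬P → ∀¬P (Fin.fromℕ k) (≡.subst P (≡.sym (Fin.toℕ-fromℕ k)) pk))
... | m , ¬¬pm , below = toℕ m , decidable-stable (P? (toℕ m)) ¬¬pm , minimal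
  where
  minimal : ∀ {i} → i < toℕ m → ¬ P i
  minimal {i} i<m = ≡.subst (¬_ ∘ P) index (below (fromℕ< i<m))
    where
    index : toℕ (Fin.inject (fromℕ< i<m)) ≡ i
    index = ≡.trans (Fin.toℕ-inject (fromℕ< i<m)) (Fin.toℕ-fromℕ< i<m)

m*n≡o⇒n>0 : ∀ m {n o} → m * n ≡ o → 0 < o → 0 < n
m*n≡o⇒n>0 m {zero}  m*0≡o o>0 = ⊥-elim (<⇒≢ o>0 (≡.trans (≡.sym (*-zeroʳ m)) m*0≡o))
m*n≡o⇒n>0 m {suc n} _     _   = z<s

[d+m]%n≡m%n⇒n∣d : ∀ d m n .{{_ : NonZero n}} → (d + m) % n ≡ m % n → n ∣ d
[d+m]%n≡m%n⇒n∣d d m n eq = ∣m+n∣m⇒∣n (divides ((d + m) / n) quotients) (n∣m*n (m / n))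
  where
  open ≡.≡-Reasoning
  quotients : m / n * n + d ≡ (d + m) / n * n
  quotients = +-cancelˡ-≡ (m % n) _ _ (begin
    m % n + (m / n * n + d)        ≡⟨ +-assoc (m % n) _ d ⟨
    m % n + m / n * n + d          ≡⟨ ≡.cong (_+ d) (m≡m%n+[m/n]*n m n) ⟨
    m + d                          ≡⟨ +-comm m d ⟩
    d + m                          ≡⟨ m≡m%n+[m/n]*n (d + m) n ⟩
    (d + m) % n + (d + m) / n * n  ≡⟨ ≡.cong (_+ (d + m) / n * n) eq ⟩
    m % n + (d + m) / n * n        ∎)

[1+m%n]%n≡[1+m]%n : ∀ m n .{{_ : NonZero n}} → suc (m % n) % n ≡ suc m % n
[1+m%n]%n≡[1+m]%n m n = begin
  (1 + m % n) % n            ≡⟨ %-distribˡ-+ 1 (m % n) n ⟩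
  (1 % n + m % n % n) % n    ≡⟨ ≡.cong (λ r → (1 % n + r) % n) (m%n%n≡m%n m n) ⟩
  (1 % n + m % n) % n        ≡⟨ %-distribˡ-+ 1 m n ⟨
  (1 + m) % n                ∎
  where open ≡.≡-Reasoning

toℕ-mod : ∀ k n .{{_ : NonZero n}} → toℕ (k mod n) ≡ k % n
toℕ-mod k n = Fin.toℕ-fromℕ< _

toℕ-next : ∀ {n} .{{_ : NonZero n}} (i : Fin n) → toℕ (next i) ≡ suc (toℕ i) % n
toℕ-next {suc n} i = Fin.toℕ-fromℕ< _

next-mod : ∀ k n .{{_ : NonZero n}} → next (k mod n) ≡ suc k mod n
next-mod k n = Fin.toℕ-injective (begin
  toℕ (next (k mod n))   ≡⟨ toℕ-next (k mod n) ⟩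
  suc (toℕ (k mod n)) % n ≡⟨ ≡.cong (λ r → suc r % n) (toℕ-mod k n) ⟩
  suc (k % n) % n        ≡⟨ [1+m%n]%n≡[1+m]%n k n ⟩
  suc k % n              ≡⟨ toℕ-mod (suc k) n ⟨
  toℕ (suc k mod n)      ∎)
  where open ≡.≡-Reasoning

mod≡⇒%≡ : ∀ {k l} n .{{_ : NonZero n}} → k mod n ≡ l mod n → k % n ≡ l % n
mod≡⇒%≡ {k} {l} n eq = ≡.trans (≡.sym (toℕ-mod k n)) (≡.trans (≡.cong toℕ eq) (toℕ-mod l n))

mod-periodic : ∀ k n .{{_ : NonZero n}} → (k + n) mod n ≡ k mod n
mod-periodic k n = Fin.toℕ-injective (begin
  toℕ ((k + n) mod n)  ≡⟨ toℕ-mod (k + n) n ⟩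
  (k + n) % n          ≡⟨ [m+n]%n≡m%n k n ⟩
  k % n                ≡⟨ toℕ-mod k n ⟨
  toℕ (k mod n)        ∎)
  where open ≡.≡-Reasoning

toℕ-+ₘ : ∀ {n} .{{_ : NonZero n}} (a b : Fin n) → toℕ (a +ₘ b) ≡ (toℕ a + toℕ b) % n
toℕ-+ₘ {suc n} a b = Fin.toℕ-fromℕ< _

module _ (G : FiniteAbelianGroup) where
  open FiniteAbelianGroup G
    renaming (refl to ≈-refl; sym to ≈-sym; trans to ≈-trans; reflexive to ≈-reflexive)
  open Inverse enumeration using (to; from; from-cong; strictlyInverseˡ; strictlyInverseʳ)
  open import Algebra.Properties.AbelianGroup abGroup
  open import Algebra.Properties.CommutativeSemigroup commutativeSemigroup
  -- ℕ-multiples k · g are the library's _×_, renamed to keep _×_ for products.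
  open import Algebra.Properties.CommutativeMonoid.Mult commutativeMonoid renaming (_×_ to _·_)
  open import Relation.Binary.Reasoning.Setoid setoid

  -- Counting in a finite group

  from-injective : ∀ {x y} → from x ≡ from y → x ≈ y
  from-injective {x} {y} eq = begin
    x           ≈⟨ strictlyInverseˡ x ⟨
    to (from x) ≡⟨ ≡.cong to eq ⟩
    to (from y) ≈⟨ strictlyInverseˡ y ⟩
    y           ∎

  infix 4 _≈?_
  _≈?_ : ∀ x y → Dec (x ≈ y)
  x ≈? y = map′ from-injective from-cong (from x Fin.≟ from y)

  fin-injective⇒≤ : ∀ {a} (f : Fin a → Carrier) → (∀ i j → f i ≈ f j → i ≡ j) → a ≤ order
  fin-injective⇒≤ f inj = Fin.injective⇒≤ {f = from ∘ f} (λ eq → inj _ _ (from-injective eq))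

  fin-injective⇒surjective : (f : Fin order → Carrier) → (∀ i j → f i ≈ f j → i ≡ j) →
                             ∀ x → ∃ λ i → f i ≈ x
  fin-injective⇒surjective f inj x with Fin.any? (λ i → f i ≈? x)
  ... | yes hit = hit
  ... | no ¬hit = ⊥-elim (<-irrefl ≡.refl (fin-injective⇒≤ f+x inj+x))
    where
    f+x : Fin (suc order) → Carrier
    f+x 0F          = x
    f+x (Fin.suc i) = f i
    inj+x : ∀ i j → f+x i ≈ f+x j → i ≡ j
    inj+x 0F          0F          _ = ≡.refl
    inj+x 0F          (Fin.suc j) e = ⊥-elim (¬hit (j , ≈-sym e))
    inj+x (Fin.suc i) 0F          e = ⊥-elim (¬hit (i , e))
    inj+x (Fin.suc i) (Fin.suc j) e = ≡.cong Fin.suc (inj i j e)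

  SubsetSize-≤ : ∀ {P a b} → SubsetSize G P a → SubsetSize G P b → a ≤ b
  SubsetSize-≤ (e , inj , mem , _) (e′ , _ , _ , cover′) = Fin.injective⇒≤ {f = index} injective
    where
    index : Fin _ → Fin _
    index i = proj₁ (cover′ (e i) (mem i))
    injective : ∀ {i j} → index i ≡ index j → i ≡ j
    injective {i} {j} eq = inj i j (begin
      e i           ≈⟨ proj₂ (cover′ (e i) (mem i)) ⟨
      e′ (index i)  ≡⟨ ≡.cong e′ eq ⟩
      e′ (index j)  ≈⟨ proj₂ (cover′ (e j) (mem j)) ⟩
      e j           ∎)

  SubsetSize-unique : ∀ {P a b} → SubsetSize G P a → SubsetSize G P b → a ≡ b
  SubsetSize-unique s s′ = ≤-antisym (SubsetSize-≤ s s′) (SubsetSize-≤ s′ s)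

  SubsetSize-full : ∀ {P} → (∀ x → P x) → SubsetSize G P order
  SubsetSize-full all =
      to
    , (λ i j e → ≡.trans (≡.sym (strictlyInverseʳ i)) (≡.trans (from-cong e) (strictlyInverseʳ j)))
    , (λ j → all (to j))
    , (λ x _ → from x , strictlyInverseˡ x)

  -- Multiples and the order of an element

  infix 4 _∈⟨_⟩ _∉⟨_⟩
  _∈⟨_⟩ : Carrier → Carrier → Set
  x ∈⟨ g ⟩ = ⟨_⟩ G g x

  _∉⟨_⟩ : Carrier → Carrier → Set
  x ∉⟨ g ⟩ = ¬ x ∈⟨ g ⟩

  times≡· : ∀ k g → times G k g ≡ k · g
  times≡· zero    g = ≡.refl
  times≡· (suc k) g = ≡.cong (g ∙_) (times≡· k g)

  ·∈⟨⟩ : ∀ {g x} k → k · g ≈ x → x ∈⟨ g ⟩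
  ·∈⟨⟩ {g} k e = k , ≈-trans (≈-reflexive (times≡· k g)) e

  ∈⟨⟩⇒· : ∀ {g x} → x ∈⟨ g ⟩ → ∃ λ k → k · g ≈ x
  ∈⟨⟩⇒· {g} (k , e) = k , ≈-trans (≈-reflexive (≡.sym (times≡· k g))) e

  ∈⟨⟩-resp : ∀ {g x y} → x ≈ y → x ∈⟨ g ⟩ → y ∈⟨ g ⟩
  ∈⟨⟩-resp x≈y (k , e) = k , ≈-trans e x≈y

  ·-ε : ∀ k → k · ε ≈ ε
  ·-ε zero    = ≈-refl
  ·-ε (suc k) = ≈-trans (identityˡ _) (·-ε k)

  ·-annihilated : ∀ {g p} q → p · g ≈ ε → (q * p) · g ≈ ε
  ·-annihilated {g} {p} q pg≈ε = begin
    (q * p) · g  ≈⟨ ×-assocˡ g q p ⟨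
    q · (p · g)  ≈⟨ ×-congʳ q pg≈ε ⟩
    q · ε        ≈⟨ ·-ε q ⟩
    ε            ∎

  ·-mod : ∀ {g p} .{{_ : NonZero p}} k → p · g ≈ ε → k · g ≈ (k % p) · g
  ·-mod {g} {p} k pg≈ε = begin
    k · g                          ≡⟨ ≡.cong (_· g) (m≡m%n+[m/n]*n k p) ⟩
    (k % p + k / p * p) · g        ≈⟨ ×-homo-+ g (k % p) (k / p * p) ⟩
    (k % p) · g ∙ (k / p * p) · g  ≈⟨ ∙-congˡ (·-annihilated (k / p) pg≈ε) ⟩
    (k % p) · g ∙ ε                ≈⟨ identityʳ _ ⟩
    (k % p) · g                    ∎

  ·-difference : ∀ {g i j} → i ≤ j → i · g ≈ j · g → (j ∸ i) · g ≈ ε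
  ·-difference {g} {i} {j} i≤j ig≈jg = ≈-sym (∙-cancelˡ (i · g) ε _ (begin
    i · g ∙ ε              ≈⟨ identityʳ _ ⟩
    i · g                  ≈⟨ ig≈jg ⟩
    j · g                  ≡⟨ ≡.cong (_· g) (m+[n∸m]≡n i≤j) ⟨
    (i + (j ∸ i)) · g      ≈⟨ ×-homo-+ g i (j ∸ i) ⟩
    i · g ∙ (j ∸ i) · g    ∎))

  ·-double : ∀ u g → (2 * u) · g ≈ u · g ∙ u · g
  ·-double u g = ≈-trans (×-homo-+ g u (u + 0)) (∙-congˡ (×-congˡ (+-identityʳ u)))

  InjectiveBelow : ℕ → (ℕ → Carrier) → Set
  InjectiveBelow m f = ∀ {i j} → i < m → j < m → f i ≈ f j → i ≡ j

  restrict-injective : ∀ {m f} → InjectiveBelow m f → ∀ (i j : Fin m) → f (toℕ i) ≈ f (toℕ j) → i ≡ j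
  restrict-injective inj i j e = Fin.toℕ-injective (inj (Fin.toℕ<n i) (Fin.toℕ<n j) e)

  record _HasOrder_ (g : Carrier) (p : ℕ) : Set where
    field
      positive          : 0 < p
      annihilates       : p · g ≈ ε
      ·-injectiveBelow  : InjectiveBelow p (_· g)

  -- The order is the least positive annihilator (one exists by pigeonhole): a collision
  -- a · g ≈ b · g below it would make b ∸ a a smaller one.
  HasOrder-exists : ∀ g → ∃ (g HasOrder_)
  HasOrder-exists g
    with i , j , i<j , eq ← Fin.pigeonhole (n<1+n order) (λ i → from (toℕ i · g))
    with p , (p>0 , pg≈ε) , minimal ← least-witness (λ d → (0 <? d) ×-dec (d · g ≈? ε))
           (m<n⇒0<n∸m i<j , ·-difference (<⇒≤ i<j) (from-injective eq))
    = p , record { positive = p>0 ; annihilates = pg≈ε ; ·-injectiveBelow = injective }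
    where
    no-collision : ∀ {a b} → a < b → b < p → a · g ≈ b · g → ⊥
    no-collision {a} {b} a<b b<p ag≈bg =
      minimal (≤-<-trans (m∸n≤m b a) b<p) (m<n⇒0<n∸m a<b , ·-difference (<⇒≤ a<b) ag≈bg)
    injective : InjectiveBelow p (_· g)
    injective {a} {b} a<p b<p ag≈bg with <-cmp a b
    ... | tri< a<b _ _ = ⊥-elim (no-collision a<b b<p ag≈bg)
    ... | tri≈ _ a≡b _ = a≡b
    ... | tri> _ _ b<a = ⊥-elim (no-collision b<a a<p (≈-sym ag≈bg))

  module _ {g p} (g∶p : g HasOrder p) where
    open _HasOrder_ g∶p

    private instance
      p≢0 : NonZero p
      p≢0 = >-nonZero positive

    ·-mod-fin : ∀ k → toℕ (k mod p) · g ≈ k · g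
    ·-mod-fin k = ≈-trans (≈-reflexive (≡.cong (_· g) (toℕ-mod k p))) (≈-sym (·-mod k annihilates))

    ∈⟨⟩⇒·-below : ∀ {x} → x ∈⟨ g ⟩ → ∃ λ (i : Fin p) → toℕ i · g ≈ x
    ∈⟨⟩⇒·-below x∈ = let k , kg≈x = ∈⟨⟩⇒· x∈ in k mod p , ≈-trans (·-mod-fin k) kg≈x

    HasOrder⇒SubsetSize : SubsetSize G (_∈⟨ g ⟩) p
    HasOrder⇒SubsetSize =
        (λ i → toℕ i · g)
      , restrict-injective ·-injectiveBelow
      , (λ i → ·∈⟨⟩ (toℕ i) ≈-refl)
      , (λ _ → ∈⟨⟩⇒·-below)

    infix 4 _∈⟨⟩?
    _∈⟨⟩? : ∀ x → Dec (x ∈⟨ g ⟩)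
    x ∈⟨⟩? = map′ (λ (i , e) → ·∈⟨⟩ (toℕ i) e) ∈⟨⟩⇒·-below (Fin.any? (λ i → toℕ i · g ≈? x))

    ∃∉⟨⟩ : p < order → ∃ λ h → h ∉⟨ g ⟩
    ∃∉⟨⟩ p<order =
      let i , i∉ = Fin.¬∀⟶∃¬ order (λ i → to i ∈⟨ g ⟩) (λ i → to i ∈⟨⟩?) all-in in to i , i∉
      where
      all-in : ¬ (∀ i → to i ∈⟨ g ⟩)
      all-in all = <⇒≱ p<order (SubsetSize-≤ (SubsetSize-full everything) HasOrder⇒SubsetSize)
        where
        everything : ∀ x → x ∈⟨ g ⟩
        everything x = ∈⟨⟩-resp (strictlyInverseˡ x) (all (from x))

    ·-⁻¹ : ∀ j → (j · g) ⁻¹ ≈ (ℕ.pred p * j) · g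
    ·-⁻¹ j = ≈-sym (inverseʳ-unique (j · g) _ (begin
      j · g ∙ (ℕ.pred p * j) · g  ≈⟨ ×-homo-+ g j (ℕ.pred p * j) ⟨
      (suc (ℕ.pred p) * j) · g    ≡⟨ ≡.cong (λ r → (r * j) · g) (suc-pred p) ⟩
      (p * j) · g                 ≡⟨ ≡.cong (_· g) (*-comm p j) ⟩
      (j * p) · g                 ≈⟨ ·-annihilated j annihilates ⟩
      ε                           ∎))

    ∙·≈·⇒∈⟨⟩ : ∀ {y i j} → y ∙ j · g ≈ i · g → y ∈⟨ g ⟩
    ∙·≈·⇒∈⟨⟩ {y} {i} {j} y∙jg≈ig = ·∈⟨⟩ (i + ℕ.pred p * j) (begin
      (i + ℕ.pred p * j) · g        ≈⟨ ×-homo-+ g i _ ⟩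
      i · g ∙ (ℕ.pred p * j) · g    ≈⟨ ∙-congˡ (·-⁻¹ j) ⟨
      i · g - j · g                 ≈⟨ x≈z//y y (j · g) (i · g) y∙jg≈ig ⟨
      y                             ∎)

    ·-HasOrder : ∀ d {q} .{{_ : NonZero d}} → d * q ≡ p → (d · g) HasOrder q
    ·-HasOrder d {q} dq≡p = record
      { positive         = m*n≡o⇒n>0 d dq≡p positive
      ; annihilates      = begin
          q · (d · g)   ≈⟨ ×-assocˡ g q d ⟩
          (q * d) · g   ≡⟨ ≡.cong (_· g) (≡.trans (*-comm q d) dq≡p) ⟩
          p · g         ≈⟨ annihilates ⟩
          ε             ∎
      ; ·-injectiveBelow = λ {i} {j} i<q j<q e → *-cancelʳ-≡ i j d
          (·-injectiveBelow (below i<q) (below j<q)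
            (≈-trans (≈-sym (×-assocˡ g i d)) (≈-trans e (×-assocˡ g j d))))
      }
      where
      below : ∀ {i} → i < q → i * d < p
      below {i} i<q = ≡.subst (i * d <_) (≡.trans (*-comm q d) dq≡p) (*-monoˡ-< d i<q)

  SubsetSize⇒HasOrder : ∀ {g p} → SubsetSize G (_∈⟨ g ⟩) p → g HasOrder p
  SubsetSize⇒HasOrder {g} size =
    let p , g∶p = HasOrder-exists g
    in ≡.subst (g HasOrder_) (SubsetSize-unique (HasOrder⇒SubsetSize g∶p) size) g∶p

  SubsetSize-≥2 : ∀ {P k x y} → SubsetSize G P k → P x → P y → x ≉ y → 2 ≤ k
  SubsetSize-≥2 {k = zero} (_ , _ , _ , cover) px _ _ with () ← proj₁ (cover _ px)
  SubsetSize-≥2 {k = suc zero} (_ , _ , _ , cover) px py x≉y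
    with 0F , ex ← cover _ px | 0F , ey ← cover _ py = ⊥-elim (x≉y (≈-trans (≈-sym ex) ey))
  SubsetSize-≥2 {k = suc (suc k)} _ _ _ _ = s≤s (s≤s z≤n)

  SubsetSize-2-alternation : ∀ {P x y z} → SubsetSize G P 2 → P x → P y → P z →
                             x ≉ y → y ≉ z → x ≈ z
  SubsetSize-2-alternation {x = x} {y} {z} (e , _ , _ , cover) px py pz x≉y y≉z
    with a , ea ← cover x px | b , eb ← cover y py | c , ec ← cover z pz
    = ≈-trans (≈-sym ea) (≈-trans (≈-reflexive (≡.cong e (fin2 a b c a≢b b≢c))) ec)
    where
    a≢b : a ≢ b
    a≢b a≡b = x≉y (≈-trans (≈-sym ea) (≈-trans (≈-reflexive (≡.cong e a≡b)) eb))
    b≢c : b ≢ c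
    b≢c b≡c = y≉z (≈-trans (≈-sym eb) (≈-trans (≈-reflexive (≡.cong e b≡c)) ec))
    fin2 : (a b c : Fin 2) → a ≢ b → b ≢ c → a ≡ c
    fin2 0F 0F _  a≢b _   = ⊥-elim (a≢b ≡.refl)
    fin2 1F 1F _  a≢b _   = ⊥-elim (a≢b ≡.refl)
    fin2 _  0F 0F _   b≢c = ⊥-elim (b≢c ≡.refl)
    fin2 _  1F 1F _   b≢c = ⊥-elim (b≢c ≡.refl)
    fin2 0F 1F 0F _   _   = ≡.refl
    fin2 1F 0F 1F _   _   = ≡.refl

  SubsetSize-pair : ∀ {P x y} → x ≉ y → P x → P y → (∀ z → P z → z ≈ x ⊎ z ≈ y) → SubsetSize G P 2
  SubsetSize-pair {P} {x} {y} x≉y px py split = e , injective , member , cover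
    where
    e : Fin 2 → Carrier
    e 0F = x
    e 1F = y
    injective : ∀ i j → e i ≈ e j → i ≡ j
    injective 0F 0F _   = ≡.refl
    injective 1F 1F _   = ≡.refl
    injective 0F 1F x≈y = ⊥-elim (x≉y x≈y)
    injective 1F 0F y≈x = ⊥-elim (x≉y (≈-sym y≈x))
    member : ∀ i → P (e i)
    member 0F = px
    member 1F = py
    cover : ∀ z → P z → ∃ λ i → e i ≈ z
    cover z pz with split z pz
    ... | inj₁ z≈x = 0F , ≈-sym z≈x
    ... | inj₂ z≈y = 1F , ≈-sym z≈y

  -- Hamiltonian cycles as sequences indexed by ℕ

  interleave-injectiveBelow : ∀ {a b m} → InjectiveBelow m a → InjectiveBelow m b → (∀ i j → a i ≉ b j) →
                              InjectiveBelow (2 * m) (interleave a b)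
  interleave-injectiveBelow {a} {b} {m} a-inj b-inj a≉b {k} {l} k<2m l<2m e
    with evenOrOdd k | evenOrOdd l
  ... | even i ≡.refl | even j ≡.refl =
    ≡.cong (2 *_) (a-inj (*-cancelˡ-< 2 _ _ k<2m) (*-cancelˡ-< 2 _ _ l<2m) (begin
    a i                     ≡⟨ interleave-even a b i ⟨
    interleave a b (2 * i)  ≈⟨ e ⟩
    interleave a b (2 * j)  ≡⟨ interleave-even a b j ⟩
    a j                     ∎))
  ... | odd i ≡.refl | odd j ≡.refl =
    ≡.cong (suc ∘ (2 *_)) (b-inj (*-cancelˡ-< 2 _ _ (<-trans (n<1+n _) k<2m))
                                 (*-cancelˡ-< 2 _ _ (<-trans (n<1+n _) l<2m)) (begin
    b i                           ≡⟨ interleave-odd a b i ⟨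
    interleave a b (suc (2 * i))  ≈⟨ e ⟩
    interleave a b (suc (2 * j))  ≡⟨ interleave-odd a b j ⟩
    b j                           ∎))
  ... | even i ≡.refl | odd j ≡.refl = ⊥-elim (a≉b i j (begin
    a i                           ≡⟨ interleave-even a b i ⟨
    interleave a b (2 * i)        ≈⟨ e ⟩
    interleave a b (suc (2 * j))  ≡⟨ interleave-odd a b j ⟩
    b j                           ∎))
  ... | odd i ≡.refl | even j ≡.refl = ⊥-elim (a≉b j i (begin
    a j                           ≡⟨ interleave-even a b j ⟨
    interleave a b (2 * j)        ≈⟨ e ⟨
    interleave a b (suc (2 * i))  ≡⟨ interleave-odd a b i ⟩
    b i                           ∎))

  InjectiveBelow⇒surjective : ∀ {f} → InjectiveBelow order f → ∀ x → ∃ λ k → f k ≈ x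
  InjectiveBelow⇒surjective {f} inj x =
    let i , e = fin-injective⇒surjective (f ∘ toℕ) (restrict-injective inj) x in toℕ i , e

  cycleOf : (f : ℕ → Carrier) → InjectiveBelow order f → HamCycle G
  cycleOf f inj = record
    { list       = f ∘ toℕ
    ; injective  = restrict-injective inj
    ; surjective = fin-injective⇒surjective (f ∘ toℕ) (restrict-injective inj)
    }

  module _ .{{_ : NonZero order}} where

    wrap-around : ∀ {f : ℕ → Carrier} → f order ≈ f 0 → ∀ {t} → t < order → f (suc t % order) ≈ f (suc t)
    wrap-around {f} closed {t} t<order with m≤n⇒m<n∨m≡n t<order
    ... | inj₁ 1+t<order = ≈-reflexive (≡.cong f (m<n⇒m%n≡m 1+t<order))
    ... | inj₂ 1+t≡order = begin
      f (suc t % order)  ≡⟨ ≡.cong (λ r → f (r % order)) 1+t≡order ⟩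
      f (order % order)  ≡⟨ ≡.cong f (n%n≡0 order) ⟩
      f 0                ≈⟨ closed ⟨
      f order            ≡⟨ ≡.cong f 1+t≡order ⟨
      f (suc t)          ∎

    module _ {f} (inj : InjectiveBelow order f) (closed : f order ≈ f 0) where
      open HamCycle (cycleOf f inj)

      cycleOf-edgeSum : ∀ i → list i ∙ list (next i) ≈ f (toℕ i) ∙ f (suc (toℕ i))
      cycleOf-edgeSum i =
        ∙-congˡ (≈-trans (≈-reflexive (≡.cong f (toℕ-next i))) (wrap-around {f} closed (Fin.toℕ<n i)))

      cycleOf-S⁺ : ∀ {t x} → t < order → f t ∙ f (suc t) ≈ x → S G (cycleOf f inj) x
      cycleOf-S⁺ t<order e = fromℕ< t<order , ≈-trans (cycleOf-edgeSum _)
        (≈-trans (≈-reflexive (≡.cong (λ r → f r ∙ f (suc r)) (Fin.toℕ-fromℕ< t<order))) e)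

      cycleOf-S⁻ : ∀ {x} → S G (cycleOf f inj) x → ∃ λ t → f t ∙ f (suc t) ≈ x
      cycleOf-S⁻ (i , e) = toℕ i , ≈-trans (≈-sym (cycleOf-edgeSum i)) e

    module _ (C : HamCycle G) where
      open HamCycle C

      vertex : ℕ → Carrier
      vertex k = list (k mod order)

      edgeSum : ℕ → Carrier
      edgeSum k = vertex k ∙ vertex (suc k)

      edgeSum∈S : ∀ k → S G C (edgeSum k)
      edgeSum∈S k = k mod order , ≈-reflexive (≡.cong (λ i → vertex k ∙ list i) (next-mod k order))

      vertex-injective : ∀ {a b} → vertex a ≈ vertex b → a % order ≡ b % order
      vertex-injective e = mod≡⇒%≡ order (injective _ _ e)

      vertex-periodic : ∀ k → vertex (k + order) ≡ vertex k
      vertex-periodic k = ≡.cong list (mod-periodic k order)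

  -- Cycles with two sums and cyclic subgroups of index two

  module _ (3≤order : 3 ≤ order) where
    private instance
      order≢0 : NonZero order
      order≢0 = >-nonZero (≤-trans (s≤s z≤n) 3≤order)

    edgeSum-distinct : ∀ C k → edgeSum C k ≉ edgeSum C (suc k)
    edgeSum-distinct C k e = <⇒≱ 3≤order (∣⇒≤ (order∣2))
      where
      order∣2 : order ∣ 2
      order∣2 = [d+m]%n≡m%n⇒n∣d 2 k order (≡.sym (vertex-injective C
        (∙-cancelʳ (vertex C (suc k)) _ _ (≈-trans e (comm _ _)))))

    smin≥2 : SminGe G 2
    smin≥2 C j size = SubsetSize-≥2 size (edgeSum∈S C 0) (edgeSum∈S C 1) (edgeSum-distinct C 0)

    module _ (C : HamCycle G) (size2 : SizeS G C 2) where

      edgeSum-2-periodic : ∀ k → edgeSum C (2 + k) ≈ edgeSum C k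
      edgeSum-2-periodic k = ≈-sym (SubsetSize-2-alternation size2
        (edgeSum∈S C k) (edgeSum∈S C (1 + k)) (edgeSum∈S C (2 + k))
        (edgeSum-distinct C k) (edgeSum-distinct C (1 + k)))

      edgeSum-even : ∀ j → edgeSum C (2 * j) ≈ edgeSum C 0
      edgeSum-even zero    = ≈-refl
      edgeSum-even (suc j) = ≈-trans (≈-reflexive (≡.cong (edgeSum C) (*-suc 2 j)))
        (≈-trans (edgeSum-2-periodic (2 * j)) (edgeSum-even j))

      edgeSum-odd : ∀ j → edgeSum C (suc (2 * j)) ≈ edgeSum C 1
      edgeSum-odd zero    = ≈-refl
      edgeSum-odd (suc j) = ≈-trans (≈-reflexive (≡.cong (edgeSum C ∘ suc) (*-suc 2 j)))
        (≈-trans (edgeSum-2-periodic (suc (2 * j))) (edgeSum-odd j))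

      order-even : ∃ λ m → 2 * m ≡ order
      order-even with evenOrOdd order
      ... | even m 2m≡order   = m , 2m≡order
      ... | odd j 1+2j≡order = ⊥-elim (edgeSum-distinct C 0 (begin
        edgeSum C 0              ≡⟨ ≡.cong₂ _∙_ (vertex-periodic C 0) (vertex-periodic C 1) ⟨
        edgeSum C order          ≡⟨ ≡.cong (edgeSum C) 1+2j≡order ⟨
        edgeSum C (suc (2 * j))  ≈⟨ edgeSum-odd j ⟩
        edgeSum C 1              ∎))

      vertex-suc : ∀ k → vertex C (suc k) ≈ edgeSum C k - vertex C k
      vertex-suc k = x≈z//y (vertex C (suc k)) (vertex C k) (edgeSum C k) (comm _ _)

      vertex-suc-suc : ∀ k → vertex C (2 + k) ≈ vertex C k ∙ (edgeSum C (1 + k) - edgeSum C k)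
      vertex-suc-suc k = begin
        vertex C (2 + k)                                   ≈⟨ vertex-suc (1 + k) ⟩
        edgeSum C (1 + k) - vertex C (1 + k)               ≈⟨ ∙-congˡ (⁻¹-cong (vertex-suc k)) ⟩
        edgeSum C (1 + k) ∙ (edgeSum C k - vertex C k) ⁻¹  ≈⟨ ∙-congˡ (⁻¹-anti-homo‿- _ _) ⟩
        edgeSum C (1 + k) ∙ (vertex C k - edgeSum C k)     ≈⟨ x∙yz≈y∙xz _ _ _ ⟩
        vertex C k ∙ (edgeSum C (1 + k) - edgeSum C k)     ∎

      stride : Carrier
      stride = edgeSum C 1 - edgeSum C 0

      vertex-even : ∀ j → vertex C (2 * j) ≈ vertex C 0 ∙ j · stride
      vertex-even zero    = ≈-sym (identityʳ _)
      vertex-even (suc j) = begin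
        vertex C (2 * suc j)                ≡⟨ ≡.cong (vertex C) (*-suc 2 j) ⟩
        vertex C (2 + 2 * j)                ≈⟨ vertex-suc-suc (2 * j) ⟩
        vertex C (2 * j) ∙ (edgeSum C (1 + 2 * j) - edgeSum C (2 * j))
          ≈⟨ ∙-cong (vertex-even j) (∙-cong (edgeSum-odd j) (⁻¹-cong (edgeSum-even j))) ⟩
        (vertex C 0 ∙ j · stride) ∙ stride      ≈⟨ assoc _ _ _ ⟩
        vertex C 0 ∙ (j · stride ∙ stride)      ≈⟨ ∙-congˡ (comm _ _) ⟩
        vertex C 0 ∙ suc j · stride           ∎

      stride-HasOrder : ∀ {m} → 2 * m ≡ order → stride HasOrder m
      stride-HasOrder {m} 2m≡order = record
        { positive         = m*n≡o⇒n>0 2 2m≡order (≤-trans (s≤s z≤n) 3≤order)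
        ; annihilates      = ∙-cancelˡ (vertex C 0) _ _ (begin
            vertex C 0 ∙ m · stride  ≈⟨ vertex-even m ⟨
            vertex C (2 * m)       ≡⟨ ≡.cong (vertex C) 2m≡order ⟩
            vertex C order         ≡⟨ vertex-periodic C 0 ⟩
            vertex C 0             ≈⟨ identityʳ _ ⟨
            vertex C 0 ∙ ε         ∎)
        ; ·-injectiveBelow = λ {i} {j} i<m j<m e → *-cancelˡ-≡ i j 2 (≡.trans
            (≡.sym (m<n⇒m%n≡m (below i<m)))
            (≡.trans (vertex-injective C (≈-trans (vertex-even i)
                                           (≈-trans (∙-congˡ e) (≈-sym (vertex-even j)))))
                     (m<n⇒m%n≡m (below j<m))))
        }
        where
        below : ∀ {i} → i < m → 2 * i < order
        below i<m = ≡.subst (_ <_) 2m≡order (*-monoʳ-< 2 i<m)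

      sizeS2⇒index2 : HasCyclicSubgroupOfIndex2 G
      sizeS2⇒index2 = let m , 2m≡order = order-even
                      in stride , m , HasOrder⇒SubsetSize (stride-HasOrder 2m≡order) , 2m≡order

    module _ {g m} (g∶m : g HasOrder m) (2m≡order : 2 * m ≡ order) where
      open _HasOrder_ g∶m

      private instance
        m≢0 : NonZero m
        m≢0 = >-nonZero positive

      m<order : m < order
      m<order = ≡.subst (m <_) (≡.trans (*-comm m 2) 2m≡order) (m<m*n m 2 (s≤s (s≤s z≤n)))

      2≤m : 2 ≤ m
      2≤m = ≮⇒≥ λ m<2 → <⇒≱ 3≤order (≡.subst (_≤ 2) 2m≡order (*-monoʳ-≤ 2 (ℕ.s≤s⁻¹ m<2)))

      g≉ε : g ≉ ε
      g≉ε g≈ε with () ← ·-injectiveBelow 2≤m positive (≈-trans (identityʳ g) g≈ε)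

      module _ {h} (h∉ : h ∉⟨ g ⟩) where

        zigzag : ℕ → Carrier
        zigzag = interleave (_· g) (λ j → h - j · g)

        zigzag-injective : InjectiveBelow order zigzag
        zigzag-injective = ≡.subst (λ n → InjectiveBelow n zigzag) 2m≡order
          (interleave-injectiveBelow ·-injectiveBelow
            (λ i<m j<m e → ·-injectiveBelow i<m j<m (⁻¹-injective (∙-cancelˡ h _ _ e)))
            (λ i j e → h∉ (·∈⟨⟩ (i + j) (begin
              (i + j) · g          ≈⟨ ×-homo-+ g i j ⟩
              i · g ∙ j · g        ≈⟨ ∙-congʳ e ⟩
              (h - j · g) ∙ j · g  ≈⟨ //-rightDividesˡ (j · g) h ⟩
              h                    ∎))))

        zigzag-closed : zigzag order ≈ zigzag 0
        zigzag-closed = begin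
          zigzag order    ≡⟨ ≡.cong zigzag 2m≡order ⟨
          zigzag (2 * m)  ≡⟨ interleave-even _ _ m ⟩
          m · g           ≈⟨ annihilates ⟩
          ε               ∎

        zigzag-edgeSum-even : ∀ j → zigzag (2 * j) ∙ zigzag (suc (2 * j)) ≈ h
        zigzag-edgeSum-even j = begin
          zigzag (2 * j) ∙ zigzag (suc (2 * j))  ≡⟨ ≡.cong₂ _∙_ (interleave-even _ _ j) (interleave-odd _ _ j) ⟩
          j · g ∙ (h - j · g)                    ≈⟨ assoc _ _ _ ⟨
          j · g ∙ h - j · g                      ≈⟨ xyx⁻¹≈y _ _ ⟩
          h                                      ∎

        zigzag-edgeSum-odd : ∀ j → zigzag (suc (2 * j)) ∙ zigzag (2 + 2 * j) ≈ h ∙ g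
        zigzag-edgeSum-odd j = begin
          zigzag (suc (2 * j)) ∙ zigzag (2 + 2 * j)
            ≡⟨ ≡.cong₂ _∙_ (interleave-odd _ _ j)
                 (≡.trans (≡.cong zigzag (≡.sym (*-suc 2 j))) (interleave-even _ _ (suc j))) ⟩
          (h - j · g) ∙ (g ∙ j · g)                  ≈⟨ interchange _ _ _ _ ⟩
          (h ∙ g) ∙ ((j · g) ⁻¹ ∙ j · g)             ≈⟨ ∙-congˡ (inverseˡ _) ⟩
          (h ∙ g) ∙ ε                                ≈⟨ identityʳ _ ⟩
          h ∙ g                                      ∎

        zigzag-cycle : HamCycle G
        zigzag-cycle = cycleOf zigzag zigzag-injective

        zigzag-S : ∀ x → S G zigzag-cycle x → x ≈ h ⊎ x ≈ h ∙ g
        zigzag-S x x∈S with t , e ← cycleOf-S⁻ zigzag-injective zigzag-closed x∈S | evenOrOdd t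
        ... | even j ≡.refl = inj₁ (≈-trans (≈-sym e) (zigzag-edgeSum-even j))
        ... | odd j ≡.refl  = inj₂ (≈-trans (≈-sym e) (zigzag-edgeSum-odd j))

        zigzag-sizeS : SizeS G zigzag-cycle 2
        zigzag-sizeS = SubsetSize-pair (λ h≈hg → g≉ε (identityʳ-unique h g (≈-sym h≈hg)))
          (cycleOf-S⁺ zigzag-injective zigzag-closed (≤-trans (s≤s z≤n) 3≤order) (zigzag-edgeSum-even 0))
          (cycleOf-S⁺ zigzag-injective zigzag-closed (≤-trans (s≤s (s≤s z≤n)) 3≤order) (zigzag-edgeSum-odd 0))
          zigzag-S

      coset-injective : ∀ {y} → y ∉⟨ g ⟩ → InjectiveBelow order (interleave (_· g) (λ j → y ∙ j · g))
      coset-injective {y} y∉ =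
        ≡.subst (λ n → InjectiveBelow n (interleave (_· g) (λ j → y ∙ j · g))) 2m≡order
          (interleave-injectiveBelow ·-injectiveBelow
            (λ i<m j<m e → ·-injectiveBelow i<m j<m (∙-cancelˡ y _ _ e))
            (λ i j e → y∉ (∙·≈·⇒∈⟨⟩ g∶m {i = i} {j} (≈-sym e))))

      coset-cover : ∀ {y} → y ∉⟨ g ⟩ → ∀ x → (∃ λ j → j · g ≈ x) ⊎ (∃ λ j → y ∙ j · g ≈ x)
      coset-cover {y} y∉ x with k , e ← InjectiveBelow⇒surjective (coset-injective y∉) x | evenOrOdd k
      ... | even j ≡.refl = inj₁ (j , ≈-trans (≈-reflexive (≡.sym (interleave-even _ _ j))) e)
      ... | odd j ≡.refl  = inj₂ (j , ≈-trans (≈-reflexive (≡.sym (interleave-odd _ _ j))) e)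

      square∈⟨⟩ : ∀ {h} → h ∉⟨ g ⟩ → ∃ λ j → h ∙ h ≈ j · g
      square∈⟨⟩ {h} h∉ with coset-cover h∉ (h ∙ h)
      ... | inj₁ (j , jg≈hh)   = j , ≈-sym jg≈hh
      ... | inj₂ (j , h∙jg≈hh) = ⊥-elim (h∉ (·∈⟨⟩ j (∙-cancelˡ h _ _ h∙jg≈hh)))

      halve : ∀ {h} r u → h ∉⟨ g ⟩ → h ∙ h ≈ (r + 2 * u) · g → ∃ λ y → y ∉⟨ g ⟩ × y ∙ y ≈ r · g
      halve {h} r u h∉ hh≈ = h - u · g , y∉ , yy≈
        where
        y∉ : h - u · g ∉⟨ g ⟩
        y∉ y∈ with k , kg≈y ← ∈⟨⟩⇒· y∈ = h∉ (·∈⟨⟩ (k + u) (begin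
          (k + u) · g          ≈⟨ ×-homo-+ g k u ⟩
          k · g ∙ u · g        ≈⟨ ∙-congʳ kg≈y ⟩
          (h - u · g) ∙ u · g  ≈⟨ //-rightDividesˡ (u · g) h ⟩
          h                    ∎))
        yy≈ : (h - u · g) ∙ (h - u · g) ≈ r · g
        yy≈ = begin
          (h - u · g) ∙ (h - u · g)                  ≈⟨ interchange _ _ _ _ ⟩
          (h ∙ h) ∙ ((u · g) ⁻¹ ∙ (u · g) ⁻¹)        ≈⟨ ∙-cong hh≈ (⁻¹-∙-comm _ _) ⟩
          (r + 2 * u) · g - (u · g ∙ u · g)          ≈⟨ ∙-congʳ (×-homo-+ g r (2 * u)) ⟩
          r · g ∙ (2 * u) · g - (u · g ∙ u · g)      ≈⟨ ∙-congʳ (∙-congˡ (·-double u g)) ⟩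
          r · g ∙ (u · g ∙ u · g) - (u · g ∙ u · g)  ≈⟨ //-rightDividesʳ _ _ ⟩
          r · g                                      ∎

      2∣order : 2 ∣ order
      2∣order = divides m (≡.trans (≡.sym 2m≡order) (*-comm 2 m))

      square-root-generates : ∀ {y} → y ∉⟨ g ⟩ → y ∙ y ≈ 1 · g → IsCyclic G
      square-root-generates {y} y∉ yy≈g = y , λ x → generated x (coset-cover y∉ x)
        where
        even-multiple : ∀ j → (2 * j) · y ≈ j · g
        even-multiple j = begin
          (2 * j) · y    ≈⟨ ·-double j y ⟩
          j · y ∙ j · y  ≈⟨ ×-distrib-+ y y j ⟨
          j · (y ∙ y)    ≈⟨ ×-congʳ j (≈-trans yy≈g (identityʳ g)) ⟩
          j · g          ∎
        generated : ∀ x → (∃ λ j → j · g ≈ x) ⊎ (∃ λ j → y ∙ j · g ≈ x) → x ∈⟨ y ⟩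
        generated x (inj₁ (j , jg≈x))   = ·∈⟨⟩ (2 * j) (≈-trans (even-multiple j) jg≈x)
        generated x (inj₂ (j , y∙jg≈x)) = ·∈⟨⟩ (suc (2 * j)) (≈-trans (∙-congˡ (even-multiple j)) y∙jg≈x)

      involution-splits : ∀ {y} → y ∉⟨ g ⟩ → y ∙ y ≈ ε → 2 ∣ m → IsOfType2 G m
      involution-splits {y} y∉ yy≈ε 2∣m = 2∣m , φ , φ-homo , φ-injective , φ-surjective
        where
        φ : Fin 2 × Fin m → Carrier
        φ (a , b) = toℕ a · y ∙ toℕ b · g

        2y≈ε : 2 · y ≈ ε
        2y≈ε = ≈-trans (∙-congˡ (identityʳ y)) yy≈ε

        φ-homo : ∀ a b c d → φ (a +ₘ c , b +ₘ d) ≈ φ (a , b) ∙ φ (c , d)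
        φ-homo a b c d = begin
          toℕ (a +ₘ c) · y ∙ toℕ (b +ₘ d) · g
            ≡⟨ ≡.cong₂ (λ r s → r · y ∙ s · g) (toℕ-+ₘ a c) (toℕ-+ₘ b d) ⟩
          ((toℕ a + toℕ c) % 2) · y ∙ ((toℕ b + toℕ d) % m) · g
            ≈⟨ ∙-cong (·-mod (toℕ a + toℕ c) 2y≈ε) (·-mod (toℕ b + toℕ d) annihilates) ⟨
          (toℕ a + toℕ c) · y ∙ (toℕ b + toℕ d) · g
            ≈⟨ ∙-cong (×-homo-+ y (toℕ a) (toℕ c)) (×-homo-+ g (toℕ b) (toℕ d)) ⟩
          (toℕ a · y ∙ toℕ c · y) ∙ (toℕ b · g ∙ toℕ d · g)
            ≈⟨ interchange _ _ _ _ ⟩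
          φ (a , b) ∙ φ (c , d) ∎

        same-coset : ∀ {z} (b d : Fin m) → z ∙ toℕ b · g ≈ z ∙ toℕ d · g → b ≡ d
        same-coset b d e = restrict-injective ·-injectiveBelow b d (∙-cancelˡ _ _ _ e)

        other-coset : ∀ (b d : Fin m) → ε ∙ toℕ b · g ≉ (y ∙ ε) ∙ toℕ d · g
        other-coset b d e = y∉ (∙·≈·⇒∈⟨⟩ g∶m {i = toℕ b} {toℕ d} (begin
          y ∙ toℕ d · g        ≈⟨ ∙-congʳ (identityʳ y) ⟨
          (y ∙ ε) ∙ toℕ d · g  ≈⟨ e ⟨
          ε ∙ toℕ b · g        ≈⟨ identityˡ _ ⟩
          toℕ b · g            ∎))

        φ-injective : ∀ p q → φ p ≈ φ q → p ≡ q
        φ-injective (0F , b) (0F , d) e = ≡.cong (0F ,_) (same-coset b d e)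
        φ-injective (1F , b) (1F , d) e = ≡.cong (1F ,_) (same-coset b d e)
        φ-injective (0F , b) (1F , d) e = ⊥-elim (other-coset b d e)
        φ-injective (1F , b) (0F , d) e = ⊥-elim (other-coset d b (≈-sym e))

        φ-surjective : ∀ x → ∃ λ p → φ p ≈ x
        φ-surjective x with coset-cover y∉ x
        ... | inj₁ (j , jg≈x)   = (0F , j mod m) , ≈-trans (identityˡ _) (≈-trans (·-mod-fin g∶m j) jg≈x)
        ... | inj₂ (j , y∙jg≈x) = (1F , j mod m) ,
                                   ≈-trans (∙-cong (identityʳ y) (·-mod-fin g∶m j)) y∙jg≈x

      cyclic⊎type2 : (IsCyclic G × 2 ∣ order) ⊎ (∃ λ m′ → 2 ≤ m′ × IsOfType2 G m′)
      cyclic⊎type2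
        with h , h∉ ← ∃∉⟨⟩ g∶m m<order
        with j , hh≈jg ← square∈⟨⟩ h∉
        with evenOrOdd j
      ... | odd u ≡.refl
          with y , y∉ , yy≈g ← halve 1 u h∉ hh≈jg
          = inj₁ (square-root-generates y∉ yy≈g , 2∣order)
      ... | even t ≡.refl
          with y , y∉ , yy≈ε ← halve 0 t h∉ hh≈jg
          with evenOrOdd m
      ...   | even s 2s≡m =
            inj₂ (m , 2≤m , involution-splits y∉ yy≈ε (divides s (≡.trans (≡.sym 2s≡m) (*-comm 2 s))))
      ...   | odd s 1+2s≡m
            with z , z∉ , zz≈g ← halve 1 s y∉ (begin
              y ∙ y            ≈⟨ yy≈ε ⟩
              ε                ≈⟨ annihilates ⟨
              m · g            ≡⟨ ≡.cong (_· g) 1+2s≡m ⟨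
              (1 + 2 * s) · g  ∎)
            = inj₁ (square-root-generates z∉ zz≈g , 2∣order)

    sminEq2⇒index2 : SminEq G 2 → HasCyclicSubgroupOfIndex2 G
    sminEq2⇒index2 (_ , C , size2) = sizeS2⇒index2 C size2

    index2⇒sminEq2 : HasCyclicSubgroupOfIndex2 G → SminEq G 2
    index2⇒sminEq2 (g , m , size , 2m≡order) =
      let h , h∉ = ∃∉⟨⟩ g∶m (m<order g∶m 2m≡order)
      in smin≥2 , zigzag-cycle g∶m 2m≡order h∉ , zigzag-sizeS g∶m 2m≡order h∉
      where
      g∶m : g HasOrder m
      g∶m = SubsetSize⇒HasOrder size

    index2⇒cyclic⊎type2 : HasCyclicSubgroupOfIndex2 G →
                          (IsCyclic G × 2 ∣ order) ⊎ (∃ λ m → 2 ≤ m × IsOfType2 G m)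
    index2⇒cyclic⊎type2 (g , m , size , 2m≡order) = cyclic⊎type2 (SubsetSize⇒HasOrder size) 2m≡order

  -- Cyclic groups of even order and groups of type (2, m)

  Fin-×-enumeration⇒order : ∀ {a b} (φ : Fin a × Fin b → Carrier) → (∀ p q → φ p ≈ φ q → p ≡ q) →
                            (∀ x → ∃ λ p → φ p ≈ x) → a * b ≡ order
  Fin-×-enumeration⇒order {a} {b} φ injective surjective =
    SubsetSize-unique (φ ∘ Fin.remQuot b , injective′ , (λ _ → tt) , surjective′)
                      (SubsetSize-full (λ _ → tt))
    where
    injective′ : ∀ i j → φ (Fin.remQuot b i) ≈ φ (Fin.remQuot b j) → i ≡ j
    injective′ i j e = ≡.trans (≡.sym (Fin.combine-remQuot {a} b i))
      (≡.trans (≡.cong (uncurry Fin.combine) (injective _ _ e)) (Fin.combine-remQuot {a} b j))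
    surjective′ : ∀ x → ⊤ → ∃ λ i → φ (Fin.remQuot b i) ≈ x
    surjective′ x _ = let (r , q) , e = surjective x
      in Fin.combine r q , ≈-trans (≈-reflexive (≡.cong φ (Fin.remQuot-combine r q))) e

  cyclic⇒index2 : IsCyclic G → 2 ∣ order → HasCyclicSubgroupOfIndex2 G
  cyclic⇒index2 (g , generates) (divides q order≡q*2) =
    2 · g , q , HasOrder⇒SubsetSize (·-HasOrder g∶order 2 2q≡order) , 2q≡order
    where
    g∶order : g HasOrder order
    g∶order = SubsetSize⇒HasOrder (SubsetSize-full generates)
    2q≡order : 2 * q ≡ order
    2q≡order = ≡.trans (*-comm 2 q) (≡.sym order≡q*2)

  type2⇒index2 : ∀ {m} → 2 ≤ m → IsOfType2 G m → HasCyclicSubgroupOfIndex2 G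
  type2⇒index2 {suc zero} (s≤s ()) _
  type2⇒index2 {m@(suc (suc _))} _ (_ , φ , φ-homo , φ-injective , φ-surjective) =
    g , m , HasOrder⇒SubsetSize g∶m , Fin-×-enumeration⇒order φ φ-injective φ-surjective
    where
    g : Carrier
    g = φ (0F , 1F)

    φ-zero : φ (0F , 0F) ≈ ε
    φ-zero = identityˡ-unique _ _ (≈-sym (φ-homo 0F 0F 0F 0F))

    multiples : ∀ k → k · g ≈ φ (0F , k mod m)
    multiples zero    = ≈-sym φ-zero
    multiples (suc k) = begin
      g ∙ k · g                ≈⟨ ∙-congˡ (multiples k) ⟩
      g ∙ φ (0F , k mod m)     ≈⟨ φ-homo _ _ _ _ ⟨
      φ (0F , next (k mod m))  ≡⟨ ≡.cong (λ b → φ (0F , b)) (next-mod k m) ⟩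
      φ (0F , suc k mod m)     ∎

    g∶m : g HasOrder m
    g∶m = record
      { positive         = z<s
      ; annihilates      = begin
          m · g              ≈⟨ multiples m ⟩
          φ (0F , m mod m)   ≡⟨ ≡.cong (λ b → φ (0F , b)) m-mod-m ⟩
          φ (0F , 0F)        ≈⟨ φ-zero ⟩
          ε                  ∎
      ; ·-injectiveBelow = λ {i} {j} i<m j<m e → ≡.trans (≡.sym (m<n⇒m%n≡m i<m)) (≡.trans
          (mod≡⇒%≡ {i} {j} m (≡.cong proj₂ (φ-injective _ _
            (≈-trans (≈-sym (multiples i)) (≈-trans e (multiples j))))))
          (m<n⇒m%n≡m j<m))
      }
      where
      m-mod-m : m mod m ≡ 0F
      m-mod-m = Fin.toℕ-injective (≡.trans (toℕ-mod m m) (n%n≡0 m))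

  cyclic⊎type2⇒index2 : (IsCyclic G × 2 ∣ order) ⊎ (∃ λ m → 2 ≤ m × IsOfType2 G m) →
                        HasCyclicSubgroupOfIndex2 G
  cyclic⊎type2⇒index2 (inj₁ (cyclic , 2∣order)) = cyclic⇒index2 cyclic 2∣order
  cyclic⊎type2⇒index2 (inj₂ (m , 2≤m , type2)) = type2⇒index2 2≤m type2

corollary2 : (G : FiniteAbelianGroup) → 3 ≤ FiniteAbelianGroup.order G →
    SminGe G 2 ×
    (SminEq G 2 ⇔ HasCyclicSubgroupOfIndex2 G) ×
    (SminEq G 2 ⇔ ((IsCyclic G × 2 ∣ FiniteAbelianGroup.order G) ⊎ (∃ λ m → 2 ≤ m × IsOfType2 G m)))
corollary2 G 3≤order =
    smin≥2 G 3≤order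
  , mk⇔ (sminEq2⇒index2 G 3≤order) (index2⇒sminEq2 G 3≤order)
  , mk⇔ (index2⇒cyclic⊎type2 G 3≤order ∘ sminEq2⇒index2 G 3≤order)
        (index2⇒sminEq2 G 3≤order ∘ cyclic⊎type2⇒index2 G)
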